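{- Let $n\ge 20$ and let $G$ be a barbell. Let $b:V(G)\to\mathbb Z_{\ge0}$ be such that $9n/10\le b(v)\le n$ and $b(v)$ is even for each $v\in V(G)$. Then $G$ has a perfect $b$-matching $\omega$ such that $\omega(e)\ge n/10$ for each $e\in E(G)$.
   Context: A barbell is the 7-vertex graph obtained from two vertex-disjoint triangles $a_1a_2a_3$ and $b_1b_2b_3$ by adding a new vertex $c$ together with the edges $ca_1$ and $cb_1$. For a graph $G$ and $b:V(G)\to\mathbb Z_{\ge0}$, a perfect $b$-matching is a function $\omega:E(G)\to\mathbb Z_{\ge0}$ such that $\sum_{w\in N(v)}\omega(wv)=b(v)$ for every $v\in V(G)$. -}

module Defs where

open import Data.Nat using (ℕ; _+_; _*_; _≤_)
open import Data.Fin using (Fin; zero; suc; _≟_)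
open import Data.List using (List; []; _∷_)
open import Data.Product using (_×_; _,_; proj₁; proj₂)
open import Relation.Nullary using (yes; no)
open import Relation.Binary.PropositionalEquality using (_≡_)

-- The barbell, fixed concretely on vertex set Fin 7:
--   a₁ a₂ a₃ = 0 1 2 ,  b₁ b₂ b₃ = 3 4 5 ,  c = 6.
-- (Every barbell is isomorphic to this one, and the property
--  "has a perfect b-matching with all weights ≥ n/10" is invariant
--  under isomorphism, b being arbitrary.)
Vertex : Set
Vertex = Fin 7

a₁ a₂ a₃ b₁ b₂ b₃ c : Vertex
a₁ = zero
a₂ = suc zero
a₃ = suc (suc zero)
b₁ = suc (suc (suc zero))
b₂ = suc (suc (suc (suc zero)))
b₃ = suc (suc (suc (suc (suc zero))))
c  = suc (suc (suc (suc (suc (suc zero)))))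

data Edge : Set where
  e-a₁a₂ e-a₂a₃ e-a₁a₃ e-b₁b₂ e-b₂b₃ e-b₁b₃ e-ca₁ e-cb₁ : Edge

ends : Edge → Vertex × Vertex
ends e-a₁a₂ = a₁ , a₂
ends e-a₂a₃ = a₂ , a₃
ends e-a₁a₃ = a₁ , a₃
ends e-b₁b₂ = b₁ , b₂
ends e-b₂b₃ = b₂ , b₃
ends e-b₁b₃ = b₁ , b₃
ends e-ca₁  = c  , a₁
ends e-cb₁  = c  , b₁

edges : List Edge
edges = e-a₁a₂ ∷ e-a₂a₃ ∷ e-a₁a₃ ∷ e-b₁b₂ ∷ e-b₂b₃ ∷ e-b₁b₃ ∷ e-ca₁ ∷ e-cb₁ ∷ []

incident : Vertex → (Edge → ℕ) → Edge → ℕ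
incident v ω e with v ≟ proj₁ (ends e) | v ≟ proj₂ (ends e)
... | yes _ | _     = ω e
... | no _  | yes _ = ω e
... | no _  | no _  = 0

-- Σ_{w ∈ N(v)} ω(wv) = Σ over edges e incident to v of ω(e) (G is simple).
weightAt : (Edge → ℕ) → Vertex → ℕ
weightAt ω v = go edges
  where
  go : List Edge → ℕ
  go []       = 0
  go (e ∷ es) = incident v ω e + go es

IsPerfectBMatching : (Vertex → ℕ) → (Edge → ℕ) → Set
IsPerfectBMatching b ω = ∀ v → weightAt ω v ≡ b v

module Submission where

open import Defs
open import Data.Nat using (ℕ; _*_; _≤_)
open import Data.Nat.Divisibility using (_∣_)
open import Data.Product using (Σ; _×_)

open import Data.Fin using (zero; suc)
open import Data.List using ([]; _∷_)
open import Data.Nat using (suc; _+_; _∸_; ⌊_/2⌋; ⌈_/2⌉)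
open import Data.Nat.Properties
open import Data.Nat.Tactic.RingSolver using (solve)
open import Data.Product using (_,_)
open import Relation.Binary.PropositionalEquality

-- Write b = 2h, so 9n ≤ 20h ≤ 10n. The demand of c is split as 2p + 2q over
-- ca₁ and cb₁ with p = ⌊h(c)/2⌋, q = ⌈h(c)/2⌉, so 20p, 20q ≤ 6n once n ≥ 10.
-- Each triangle is then left with even demands 2u₁, 2u₂, 2u₃, met exactly by
-- giving the edge opposite vertex k the weight u₁ + u₂ + u₃ − 2uₖ. The loaded
-- vertex keeps 20u₁ ≥ 9n − 6n = 3n, so every such weight is at least
-- (3n + 9n − 10n)/20 = n/10; likewise 20p ≥ 9n − 6n ≥ n.

2*⌈n/2⌉≤1+n : ∀ k → 2 * ⌈ k /2⌉ ≤ suc k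
2*⌈n/2⌉≤1+n k = begin
  2 * ⌈ k /2⌉               ≡⟨ cong (⌈ k /2⌉ +_) (+-identityʳ ⌈ k /2⌉) ⟩
  ⌈ k /2⌉ + ⌈ k /2⌉         ≤⟨ +-monoʳ-≤ ⌈ k /2⌉ (⌊n/2⌋-mono (n≤1+n (suc k))) ⟩
  ⌈ k /2⌉ + suc ⌊ k /2⌋     ≡⟨ trans (+-suc ⌈ k /2⌉ ⌊ k /2⌋) (cong suc (+-comm ⌈ k /2⌉ ⌊ k /2⌋)) ⟩
  suc (⌊ k /2⌋ + ⌈ k /2⌉)   ≡⟨ cong suc (⌊n/2⌋+⌈n/2⌉≡n k) ⟩
  suc k                     ∎
  where open ≤-Reasoning

half-load-small : ∀ {n k t} → 10 ≤ n → 20 * k ≤ 10 * n → 2 * t ≤ suc k → 20 * t ≤ 6 * n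
half-load-small {n} {k} {t} n≥10 hk ht = *-cancelˡ-≤ 2 (begin
  2 * (20 * t)      ≡⟨ solve (t ∷ []) ⟩
  20 * (2 * t)      ≤⟨ *-monoʳ-≤ 20 ht ⟩
  20 * suc k        ≡⟨ *-suc 20 k ⟩
  20 + 20 * k       ≤⟨ +-mono-≤ (*-monoʳ-≤ 2 n≥10) hk ⟩
  2 * n + 10 * n    ≡⟨ solve (n ∷ []) ⟩
  2 * (6 * n)       ∎)
  where open ≤-Reasoning

residual-large : ∀ {n u t h} → u + t ≡ h → 9 * n ≤ 20 * h → 20 * t ≤ 6 * n → 3 * n ≤ 20 * u
residual-large {n} {u} {t} {h} u+t≡h lo t-small = +-cancelʳ-≤ (6 * n) (3 * n) (20 * u) (begin
  3 * n + 6 * n     ≡⟨ solve (n ∷ []) ⟩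
  9 * n             ≤⟨ lo ⟩
  20 * h            ≡⟨ cong (20 *_) u+t≡h ⟨
  20 * (u + t)      ≡⟨ *-distribˡ-+ 20 u t ⟩
  20 * u + 20 * t   ≤⟨ +-monoʳ-≤ (20 * u) t-small ⟩
  20 * u + 6 * n    ∎)
  where open ≤-Reasoning

pendant-heavy : ∀ {n u t h} → u + t ≡ h → 9 * n ≤ 20 * h → 20 * t ≤ 6 * n → n ≤ 10 * (2 * u)
pendant-heavy {n} {u} {t} u+t≡h lo t-small = begin
  n             ≤⟨ m≤m+n n (2 * n) ⟩
  3 * n         ≤⟨ residual-large {n} {u} {t} u+t≡h lo t-small ⟩
  20 * u        ≡⟨ *-assoc 10 2 u ⟩
  10 * (2 * u)  ∎
  where open ≤-Reasoning

opposite-margin : ∀ {n x y z σ} → x + y + z ≡ σ →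
  20 * x ≤ 10 * n → 3 * n ≤ 20 * y → 9 * n ≤ 20 * z → 2 * n + 20 * (2 * x) ≤ 20 * σ
opposite-margin {n} {x} {y} {z} {σ} sum hx ly lz = begin
  2 * n + 20 * (2 * x)      ≡⟨ solve (n ∷ x ∷ []) ⟩
  2 * n + 20 * x + 20 * x   ≤⟨ +-monoˡ-≤ (20 * x) (+-monoʳ-≤ (2 * n) hx) ⟩
  2 * n + 10 * n + 20 * x   ≡⟨ solve (n ∷ x ∷ []) ⟩
  3 * n + 9 * n + 20 * x    ≤⟨ +-monoˡ-≤ (20 * x) (+-mono-≤ ly lz) ⟩
  20 * y + 20 * z + 20 * x  ≡⟨ solve (x ∷ y ∷ z ∷ []) ⟩
  20 * (x + y + z)          ≡⟨ cong (20 *_) sum ⟩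
  20 * σ                    ∎
  where open ≤-Reasoning

margin⇒≤ : ∀ {n m σ} → 2 * n + 20 * m ≤ 20 * σ → m ≤ σ
margin⇒≤ {n} margin = *-cancelˡ-≤ 20 (m+n≤o⇒n≤o (2 * n) margin)

margin⇒n≤10*[σ∸m] : ∀ {n m σ} → 2 * n + 20 * m ≤ 20 * σ → n ≤ 10 * (σ ∸ m)
margin⇒n≤10*[σ∸m] {n} {m} {σ} margin = *-cancelˡ-≤ 2 (begin
  2 * n                ≤⟨ m+n≤o⇒m≤o∸n (2 * n) margin ⟩
  20 * σ ∸ 20 * m      ≡⟨ *-distribˡ-∸ 20 σ m ⟨
  20 * (σ ∸ m)         ≡⟨ *-assoc 2 10 (σ ∸ m) ⟩
  2 * (10 * (σ ∸ m))   ∎)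
  where open ≤-Reasoning

opposite-weights-sum : ∀ {x y z σ v w} → x + y + z ≡ σ → v + 2 * x ≡ σ → w + 2 * y ≡ σ →
                       v + w ≡ 2 * z
opposite-weights-sum {x} {y} {z} {σ} {v} {w} sum v+2x≡σ w+2y≡σ =
  +-cancelʳ-≡ (2 * x + 2 * y) (v + w) (2 * z) (begin
    v + w + (2 * x + 2 * y)         ≡⟨ solve (v ∷ w ∷ x ∷ y ∷ []) ⟩
    (v + 2 * x) + (w + 2 * y)       ≡⟨ cong₂ _+_ v+2x≡σ w+2y≡σ ⟩
    σ + σ                           ≡⟨ cong (λ s → s + s) sum ⟨
    x + y + z + (x + y + z)         ≡⟨ solve (x ∷ y ∷ z ∷ []) ⟩
    2 * z + (2 * x + 2 * y)         ∎)
  where open ≡-Reasoning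

module Triangle (n u₁ u₂ u₃ : ℕ)
  (lo₁ : 3 * n ≤ 20 * u₁) (lo₂ : 9 * n ≤ 20 * u₂) (lo₃ : 9 * n ≤ 20 * u₃)
  (hi₁ : 20 * u₁ ≤ 10 * n) (hi₂ : 20 * u₂ ≤ 10 * n) (hi₃ : 20 * u₃ ≤ 10 * n) where

  σ : ℕ
  σ = u₁ + u₂ + u₃

  w₁₂ w₁₃ w₂₃ : ℕ
  w₁₂ = σ ∸ 2 * u₃
  w₁₃ = σ ∸ 2 * u₂
  w₂₃ = σ ∸ 2 * u₁

  private
    u₂+u₁+u₃≡σ : u₂ + u₁ + u₃ ≡ u₁ + u₂ + u₃
    u₂+u₁+u₃≡σ = solve (u₁ ∷ u₂ ∷ u₃ ∷ [])

    u₃+u₁+u₂≡σ : u₃ + u₁ + u₂ ≡ u₁ + u₂ + u₃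
    u₃+u₁+u₂≡σ = solve (u₁ ∷ u₂ ∷ u₃ ∷ [])

    u₃+u₂+u₁≡σ : u₃ + u₂ + u₁ ≡ u₁ + u₂ + u₃
    u₃+u₂+u₁≡σ = solve (u₁ ∷ u₂ ∷ u₃ ∷ [])

    margin₁ : 2 * n + 20 * (2 * u₁) ≤ 20 * σ
    margin₁ = opposite-margin {n} {u₁} {u₂} {u₃} refl hi₁ (≤-trans (*-monoˡ-≤ n (m≤m+n 3 6)) lo₂) lo₃

    margin₂ : 2 * n + 20 * (2 * u₂) ≤ 20 * σ
    margin₂ = opposite-margin {n} {u₂} {u₁} {u₃} u₂+u₁+u₃≡σ hi₂ lo₁ lo₃

    margin₃ : 2 * n + 20 * (2 * u₃) ≤ 20 * σ
    margin₃ = opposite-margin {n} {u₃} {u₁} {u₂} u₃+u₁+u₂≡σ hi₃ lo₁ lo₂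

    w₁₂+2u₃≡σ : w₁₂ + 2 * u₃ ≡ σ
    w₁₂+2u₃≡σ = m∸n+n≡m (margin⇒≤ {n} {2 * u₃} margin₃)

    w₁₃+2u₂≡σ : w₁₃ + 2 * u₂ ≡ σ
    w₁₃+2u₂≡σ = m∸n+n≡m (margin⇒≤ {n} {2 * u₂} margin₂)

    w₂₃+2u₁≡σ : w₂₃ + 2 * u₁ ≡ σ
    w₂₃+2u₁≡σ = m∸n+n≡m (margin⇒≤ {n} {2 * u₁} margin₁)

  at₁ : w₁₂ + w₁₃ ≡ 2 * u₁
  at₁ = opposite-weights-sum {u₃} {u₂} {u₁} {σ} {w₁₂} {w₁₃} u₃+u₂+u₁≡σ w₁₂+2u₃≡σ w₁₃+2u₂≡σ

  at₂ : w₁₂ + w₂₃ ≡ 2 * u₂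
  at₂ = opposite-weights-sum {u₃} {u₁} {u₂} {σ} {w₁₂} {w₂₃} u₃+u₁+u₂≡σ w₁₂+2u₃≡σ w₂₃+2u₁≡σ

  at₃ : w₂₃ + w₁₃ ≡ 2 * u₃
  at₃ = opposite-weights-sum {u₁} {u₂} {u₃} {σ} {w₂₃} {w₁₃} refl w₂₃+2u₁≡σ w₁₃+2u₂≡σ

  heavy₁₂ : n ≤ 10 * w₁₂
  heavy₁₂ = margin⇒n≤10*[σ∸m] {n} {2 * u₃} margin₃

  heavy₁₃ : n ≤ 10 * w₁₃
  heavy₁₃ = margin⇒n≤10*[σ∸m] {n} {2 * u₂} margin₂

  heavy₂₃ : n ≤ 10 * w₂₃
  heavy₂₃ = margin⇒n≤10*[σ∸m] {n} {2 * u₁} margin₁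

module PendantTriangle (n h₁ h₂ h₃ t : ℕ)
  (lo₁ : 9 * n ≤ 20 * h₁) (lo₂ : 9 * n ≤ 20 * h₂) (lo₃ : 9 * n ≤ 20 * h₃)
  (hi₁ : 20 * h₁ ≤ 10 * n) (hi₂ : 20 * h₂ ≤ 10 * n) (hi₃ : 20 * h₃ ≤ 10 * n)
  (t-small : 20 * t ≤ 6 * n) where

  private
    u₁ : ℕ
    u₁ = h₁ ∸ t

    u₁+t≡h₁ : u₁ + t ≡ h₁
    u₁+t≡h₁ = m∸n+n≡m (*-cancelˡ-≤ {t} {h₁} 20 (≤-trans t-small (≤-trans (*-monoˡ-≤ n (m≤m+n 6 3)) lo₁)))

    module T = Triangle n u₁ h₂ h₃ (residual-large {n} {u₁} {t} u₁+t≡h₁ lo₁ t-small) lo₂ lo₃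
                        (≤-trans (*-monoʳ-≤ 20 (m∸n≤m h₁ t)) hi₁) hi₂ hi₃

  open T public using (w₁₂; w₁₃; w₂₃; at₂; at₃; heavy₁₂; heavy₁₃; heavy₂₃)

  at₁ : w₁₂ + (w₁₃ + 2 * t) ≡ 2 * h₁
  at₁ = begin
    w₁₂ + (w₁₃ + 2 * t)   ≡⟨ +-assoc w₁₂ w₁₃ (2 * t) ⟨
    w₁₂ + w₁₃ + 2 * t     ≡⟨ cong (_+ 2 * t) T.at₁ ⟩
    2 * u₁ + 2 * t        ≡⟨ *-distribˡ-+ 2 u₁ t ⟨
    2 * (u₁ + t)          ≡⟨ cong (2 *_) u₁+t≡h₁ ⟩
    2 * h₁                ∎
    where open ≡-Reasoning

module BarbellMatching {n : ℕ} (n≥10 : 10 ≤ n) (h : Vertex → ℕ)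
  (lo : ∀ v → 9 * n ≤ 20 * h v) (hi : ∀ v → 20 * h v ≤ 10 * n) where

  p q : ℕ
  p = ⌊ h c /2⌋
  q = ⌈ h c /2⌉

  p+q≡h[c] : p + q ≡ h c
  p+q≡h[c] = ⌊n/2⌋+⌈n/2⌉≡n (h c)

  q-small : 20 * q ≤ 6 * n
  q-small = half-load-small {n} {h c} {q} n≥10 (hi c) (2*⌈n/2⌉≤1+n (h c))

  p-small : 20 * p ≤ 6 * n
  p-small = ≤-trans (*-monoʳ-≤ 20 (⌊n/2⌋≤⌈n/2⌉ (h c))) q-small

  module A = PendantTriangle n (h a₁) (h a₂) (h a₃) p (lo a₁) (lo a₂) (lo a₃) (hi a₁) (hi a₂) (hi a₃) p-small
  module B = PendantTriangle n (h b₁) (h b₂) (h b₃) q (lo b₁) (lo b₂) (lo b₃) (hi b₁) (hi b₂) (hi b₃) q-small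

  ω : Edge → ℕ
  ω e-a₁a₂ = A.w₁₂
  ω e-a₂a₃ = A.w₂₃
  ω e-a₁a₃ = A.w₁₃
  ω e-b₁b₂ = B.w₁₂
  ω e-b₂b₃ = B.w₂₃
  ω e-b₁b₃ = B.w₁₃
  ω e-ca₁  = 2 * p
  ω e-cb₁  = 2 * q

  perfect : ∀ v → weightAt ω v ≡ 2 * h v
  perfect zero = trans (cong (λ s → A.w₁₂ + (A.w₁₃ + s)) (+-identityʳ (2 * p))) A.at₁
  perfect (suc zero) = trans (cong (A.w₁₂ +_) (+-identityʳ A.w₂₃)) A.at₂
  perfect (suc (suc zero)) = trans (cong (A.w₂₃ +_) (+-identityʳ A.w₁₃)) A.at₃
  perfect (suc (suc (suc zero))) = trans (cong (λ s → B.w₁₂ + (B.w₁₃ + s)) (+-identityʳ (2 * q))) B.at₁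
  perfect (suc (suc (suc (suc zero)))) = trans (cong (B.w₁₂ +_) (+-identityʳ B.w₂₃)) B.at₂
  perfect (suc (suc (suc (suc (suc zero))))) = trans (cong (B.w₂₃ +_) (+-identityʳ B.w₁₃)) B.at₃
  perfect (suc (suc (suc (suc (suc (suc zero)))))) = begin
    2 * p + (2 * q + 0)   ≡⟨ cong (2 * p +_) (+-identityʳ (2 * q)) ⟩
    2 * p + 2 * q         ≡⟨ *-distribˡ-+ 2 p q ⟨
    2 * (p + q)           ≡⟨ cong (2 *_) p+q≡h[c] ⟩
    2 * h c               ∎
    where open ≡-Reasoning

  heavy : ∀ e → n ≤ 10 * ω e
  heavy e-a₁a₂ = A.heavy₁₂
  heavy e-a₂a₃ = A.heavy₂₃
  heavy e-a₁a₃ = A.heavy₁₃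
  heavy e-b₁b₂ = B.heavy₁₂
  heavy e-b₂b₃ = B.heavy₂₃
  heavy e-b₁b₃ = B.heavy₁₃
  heavy e-ca₁  = pendant-heavy {n} {p} {q} p+q≡h[c] (lo c) q-small
  heavy e-cb₁  = pendant-heavy {n} {q} {p} (trans (+-comm q p) p+q≡h[c]) (lo c) p-small

lemma5p4 : (n : ℕ) → 20 ≤ n → (b : Vertex → ℕ) →
    (∀ v → 9 * n ≤ 10 * b v) → (∀ v → b v ≤ n) → (∀ v → 2 ∣ b v) →
    Σ (Edge → ℕ) (λ ω → IsPerfectBMatching b ω × (∀ e → n ≤ 10 * ω e))
lemma5p4 n n≥20 b lo hi even = ω , (λ v → trans (perfect v) (sym (b≡2h v))) , heavy
  where
  h : Vertex → ℕ
  h v = _∣_.quotient (even v)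

  b≡2h : ∀ v → b v ≡ 2 * h v
  b≡2h v = trans (_∣_.equality (even v)) (*-comm (h v) 2)

  10b≡20h : ∀ v → 10 * b v ≡ 20 * h v
  10b≡20h v = trans (cong (10 *_) (b≡2h v)) (sym (*-assoc 10 2 (h v)))

  open BarbellMatching (≤-trans (m≤m+n 10 10) n≥20) h
    (λ v → subst (9 * n ≤_) (10b≡20h v) (lo v))
    (λ v → subst (_≤ 10 * n) (10b≡20h v) (*-monoʳ-≤ 10 (hi v)))
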